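{- Let $p$ be a prime and let $a\in\mathbb{N}=\{0,1,2,\ldots\}$. Let $k$ be an integer with $p^a\leqslant k<2p^a$. Then, for any $b\in\mathbb{N}$ and any $r\in\mathbb{Z}$, there is an integer $n\in\{0,1,\ldots,p^{a+b}-1\}$ with $n\equiv k\pmod{p^a}$ such that $\binom nk\equiv r\pmod{p^b}$. -}

module Defs where

open import Data.Integer using (ℤ; _-_)
open import Data.Integer.Divisibility using (_∣_)

_≡_[mod_] : ℤ → ℤ → ℤ → Set
x ≡ y [mod m ] = m ∣ (x - y)

module Submission where

-- Write q = p^a and k = q + j with 0 ≤ j < q, and look for n of the
-- form n = q·m + j with m < p^b; then n < p^(a+b) and n ≡ k (mod q) hold
-- automatically, and it remains to choose m so that C(q·m + j, k) ≡ r (mod p^b).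
-- It suffices that m ↦ C(q·m + j, k) is injective modulo p^b on {0, …, p^b − 1}:
-- an injective self-map of a finite set is onto, so every residue r is attained.
--
-- For injectivity we use the integer falling factorial x^(t).  From C(n,k)·k! = n^(k)
-- one gets C(q·m + j, k)·k! = q·m·F(m) with F(m) = (q·m + j)^(j) · (q·m − 1)^(q−1),
-- a product of linear factors q·m + c with q ∤ c.  Each such factor, and hence F,
-- is G·U(m) for a nonzero constant G and a "unit-valued p-Lipschitz" function U:
-- p ∤ U(x) and p(x − y) ∣ U(x) − U(y).  Normalising at m = 1 (where C(k,k) = 1)
-- gives C(q·m + j, k)·U(1) = m·U(m), so C(m₁) − C(m₂) times the unit U(1) is
-- (m₁ − m₂) times a unit, and p^b ∣ C(m₁) − C(m₂) forces p^b ∣ m₁ − m₂.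

open import Defs

module Development where

  open import Data.Nat as ℕ using (ℕ; zero; suc; _!; _^_; _∸_; NonZero)
  import Data.Nat.Properties as ℕP
  import Data.Nat.Divisibility as ℕD
  open import Data.Nat.DivMod using (m<n⇒m%n≡m)
  open import Data.Nat.Combinatorics using (_C_; nCn≡1; nCk+nC[k+1]≡[n+1]C[k+1])
  open import Data.Nat.Primality using (Prime; euclidsLemma; prime⇒nonZero; ¬prime[1])
  open import Data.Integer using (ℤ; +_; _+_; _-_; _*_; -_; ∣_∣; _⊖_)
  import Data.Integer as Z
  import Data.Integer.Properties as ZP
  open import Data.Integer.DivMod using (_%ℕ_; _/ℕ_; a≡a%ℕn+[a/ℕn]*n; n%ℕd<d)
  open import Data.Integer.Divisibility.Signed
    using ( _∣_; divides; _∣?_; ∣⇒∣ᵤ; ∣ᵤ⇒∣; ∣-refl; ∣-trans; ∣m⇒∣m*n; ∣n⇒∣m*n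
          ; ∣m∣n⇒∣m+n; ∣m+n∣m⇒∣n; ∣m+n∣n⇒∣m; *-cancelˡ-∣; *-monoʳ-∣; *-monoˡ-∣)
  open import Data.Integer.Tactic.RingSolver using (solve-∀)
  open import Data.Fin as Fin using (Fin; toℕ; fromℕ<)
  import Data.Fin.Properties as FinP
  open import Data.Product using (∃; Σ; _,_; _×_)
  open import Data.Sum using (inj₁; inj₂; _⊎_; [_,_]′)
  open import Data.Empty using (⊥-elim)
  open import Function.Definitions using (Injective)
  open import Relation.Nullary using (¬_; yes; no)
  open import Relation.Binary.PropositionalEquality
  open ≡-Reasoning

  falling : ℤ → ℕ → ℤ
  falling x zero    = + 1
  falling x (suc t) = x * falling (x - + 1) t

  minus-suc : ∀ x s → x - + 1 - + s ≡ x - + suc s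
  minus-suc x s = trans (ZP.+-assoc x (- + 1) (- + s))
                        (cong (λ y → x + y) (sym (ZP.neg-distrib-+ (+ 1) (+ s))))

  falling-split : ∀ x s t → falling x (s ℕ.+ t) ≡ falling x s * falling (x - + s) t
  falling-split x zero    t = begin
    falling x t                ≡⟨ cong (λ y → falling y t) (sym (ZP.+-identityʳ x)) ⟩
    falling (x - + 0) t        ≡⟨ sym (ZP.*-identityˡ _) ⟩
    + 1 * falling (x - + 0) t  ∎
  falling-split x (suc s) t = begin
    x * falling (x - + 1) (s ℕ.+ t)
      ≡⟨ cong (x *_) (falling-split (x - + 1) s t) ⟩
    x * (falling (x - + 1) s * falling (x - + 1 - + s) t)
      ≡⟨ cong (λ y → x * (falling (x - + 1) s * falling y t)) (minus-suc x s) ⟩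
    x * (falling (x - + 1) s * falling (x - + suc s) t)
      ≡⟨ sym (ZP.*-assoc x _ _) ⟩
    x * falling (x - + 1) s * falling (x - + suc s) t
      ∎

  falling-last : ∀ x t → falling x (suc t) ≡ falling x t * (x - + t)
  falling-last x t = begin
    falling x (suc t)                ≡⟨ cong (falling x) (ℕP.+-comm 1 t) ⟩
    falling x (t ℕ.+ 1)              ≡⟨ falling-split x t 1 ⟩
    falling x t * ((x - + t) * + 1)  ≡⟨ cong (falling x t *_) (ZP.*-identityʳ (x - + t)) ⟩
    falling x t * (x - + t)          ∎

  binomial-falling : ∀ n k → + (n C k) * + (k !) ≡ falling (+ n) k
  binomial-falling n       zero    = refl
  binomial-falling zero    (suc k) =
    trans (ZP.*-zeroˡ (+ (suc k !))) (sym (ZP.*-zeroˡ (falling (- + 1) k)))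
  binomial-falling (suc n) (suc k) = begin
    + (suc n C suc k) * + (suc k !)
      ≡⟨ cong (λ c → + c * + (suc k !)) (sym (nCk+nC[k+1]≡[n+1]C[k+1] n k)) ⟩
    + (n C k ℕ.+ n C suc k) * + (suc k !)
      ≡⟨ cong (_* + (suc k !)) (ZP.pos-+ (n C k) (n C suc k)) ⟩
    (+ (n C k) + + (n C suc k)) * + (suc k !)
      ≡⟨ ZP.*-distribʳ-+ (+ (suc k !)) (+ (n C k)) (+ (n C suc k)) ⟩
    + (n C k) * + (suc k !) + + (n C suc k) * + (suc k !)
      ≡⟨ cong₂ _+_ split-factorial (binomial-falling n (suc k)) ⟩
    + (n C k) * + (k !) * + suc k + falling (+ n) (suc k)
      ≡⟨ cong₂ _+_ (cong (_* + suc k) (binomial-falling n k)) (falling-last (+ n) k) ⟩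
    falling (+ n) k * (+ 1 + + k) + falling (+ n) k * (+ n - + k)
      ≡⟨ collect (falling (+ n) k) (+ n) (+ k) ⟩
    (+ 1 + + n) * falling (+ n) k
      ∎
    where
    split-factorial : + (n C k) * + (suc k !) ≡ + (n C k) * + (k !) * + suc k
    split-factorial = trans (cong (+ (n C k) *_) (ZP.pos-* (suc k) (k !)))
                            (reorder (+ (n C k)) (+ suc k) (+ (k !)))
      where
      reorder : ∀ c s f → c * (s * f) ≡ c * f * s
      reorder = solve-∀
    collect : ∀ f n k → f * (+ 1 + k) + f * (n - k) ≡ (+ 1 + n) * f
    collect = solve-∀

  normalise-at-one : (c : ℕ → ℤ) (U : ℤ → ℤ) (K D : ℤ) .{{_ : Z.NonZero D}} →
    c 1 ≡ + 1 → (∀ m → c m * K ≡ D * (+ m * U (+ m))) →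
    ∀ m → c m * U (+ 1) ≡ + m * U (+ m)
  normalise-at-one c U K D c1≡1 scaled m = ZP.*-cancelˡ-≡ D _ _ (begin
    D * (c m * U (+ 1))        ≡⟨ reorder D (c m) (U (+ 1)) ⟩
    c m * (D * (+ 1 * U (+ 1))) ≡⟨ cong (c m *_) (sym (scaled 1)) ⟩
    c m * (c 1 * K)            ≡⟨ cong (λ z → c m * (z * K)) c1≡1 ⟩
    c m * (+ 1 * K)            ≡⟨ cong (c m *_) (ZP.*-identityˡ K) ⟩
    c m * K                    ≡⟨ scaled m ⟩
    D * (+ m * U (+ m))        ∎)
    where
    reorder : ∀ d c u → d * (c * u) ≡ c * (d * (+ 1 * u))
    reorder = solve-∀

  small-multiple≡0 : ∀ N d .{{_ : NonZero N}} → N ℕD.∣ d → d ℕ.< N → d ≡ 0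
  small-multiple≡0 N d N∣d d<N = trans (sym (m<n⇒m%n≡m d<N)) (ℕD.n∣m⇒m%n≡0 d N N∣d)

  small-congruent⇒equal : ∀ N m₁ m₂ .{{_ : NonZero N}} → m₁ ℕ.< N → m₂ ℕ.< N →
    + N ∣ + m₁ - + m₂ → m₁ ≡ m₂
  small-congruent⇒equal N m₁ m₂ m₁<N m₂<N N∣m₁-m₂ = by-order (ℕP.≤-total m₁ m₂)
    where
    N∣dist : N ℕD.∣ ∣ m₁ ⊖ m₂ ∣
    N∣dist = subst (λ z → N ℕD.∣ ∣ z ∣) (ZP.m-n≡m⊖n m₁ m₂) (∣⇒∣ᵤ N∣m₁-m₂)
    ordered : ∀ {u v} → u ℕ.≤ v → v ℕ.< N → N ℕD.∣ ∣ u ⊖ v ∣ → v ℕ.≤ u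
    ordered {u} {v} u≤v v<N N∣ = ℕP.m∸n≡0⇒m≤n (small-multiple≡0 N (v ∸ u)
      (subst (N ℕD.∣_) (ZP.∣⊖∣-≤ u≤v) N∣) (ℕP.≤-<-trans (ℕP.m∸n≤m v u) v<N))
    by-order : m₁ ℕ.≤ m₂ ⊎ m₂ ℕ.≤ m₁ → m₁ ≡ m₂
    by-order (inj₁ m₁≤m₂) = ℕP.≤-antisym m₁≤m₂ (ordered m₁≤m₂ m₂<N N∣dist)
    by-order (inj₂ m₂≤m₁) = sym (ℕP.≤-antisym m₂≤m₁
      (ordered m₂≤m₁ m₁<N (subst (N ℕD.∣_) (ZP.∣m⊖n∣≡∣n⊖m∣ m₁ m₂) N∣dist)))

  same-residue⇒congruent : ∀ N .{{_ : NonZero N}} x y → x %ℕ N ≡ y %ℕ N → + N ∣ x - y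
  same-residue⇒congruent N x y same = divides (x /ℕ N - y /ℕ N) (begin
    x - y
      ≡⟨ cong₂ _-_ (a≡a%ℕn+[a/ℕn]*n x N) (a≡a%ℕn+[a/ℕn]*n y N) ⟩
    (+ (x %ℕ N) + x /ℕ N * + N) - (+ (y %ℕ N) + y /ℕ N * + N)
      ≡⟨ cong (λ ρ → (+ (x %ℕ N) + x /ℕ N * + N) - (+ ρ + y /ℕ N * + N)) (sym same) ⟩
    (+ (x %ℕ N) + x /ℕ N * + N) - (+ (x %ℕ N) + y /ℕ N * + N)
      ≡⟨ cancel-residue (+ (x %ℕ N)) (x /ℕ N) (y /ℕ N) (+ N) ⟩
    (x /ℕ N - y /ℕ N) * + N
      ∎)
    where
    cancel-residue : ∀ ρ u v n → (ρ + u * n) - (ρ + v * n) ≡ (u - v) * n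
    cancel-residue = solve-∀

  injective⇒surjective : ∀ {n} (f : Fin n → Fin n) → Injective _≡_ _≡_ f →
    ∀ y → ∃ λ x → f x ≡ y
  injective⇒surjective {suc n} f f-inj y with FinP.any? (λ x → f x Fin.≟ y)
  ... | yes hit = hit
  ... | no  miss = ⊥-elim (ℕP.1+n≰n (FinP.injective⇒≤ squeeze-injective))
    where
    -- Since y is missed, f factors through Fin n by removing y.
    squeeze : Fin (suc n) → Fin n
    squeeze x = Fin.punchOut {i = y} {j = f x} (λ e → miss (x , sym e))
    squeeze-injective : Injective _≡_ _≡_ squeeze
    squeeze-injective {x} {x′} e = f-inj (FinP.punchOut-injective
      (λ e → miss (x , sym e)) (λ e → miss (x′ , sym e)) e)

  hits-every-residue : ∀ N .{{_ : NonZero N}} (c : ℕ → ℤ) →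
    (∀ m₁ m₂ → m₁ ℕ.< N → m₂ ℕ.< N → + N ∣ c m₁ - c m₂ → m₁ ≡ m₂) →
    ∀ r → ∃ λ m → m ℕ.< N × + N ∣ c m - r
  hits-every-residue N c c-inj r =
    from-preimage (injective⇒surjective residue residue-injective target)
    where
    residue : Fin N → Fin N
    residue i = fromℕ< (n%ℕd<d (c (toℕ i)) N)
    residue-toℕ : ∀ i → toℕ (residue i) ≡ c (toℕ i) %ℕ N
    residue-toℕ i = FinP.toℕ-fromℕ< _
    residue-injective : Injective _≡_ _≡_ residue
    residue-injective {i} {i′} e = FinP.toℕ-injective (c-inj _ _ (FinP.toℕ<n i) (FinP.toℕ<n i′)
      (same-residue⇒congruent N (c (toℕ i)) (c (toℕ i′))
        (trans (sym (residue-toℕ i)) (trans (cong toℕ e) (residue-toℕ i′)))))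
    target : Fin N
    target = fromℕ< (n%ℕd<d r N)
    from-preimage : ∃ (λ i → residue i ≡ target) → ∃ λ m → m ℕ.< N × + N ∣ c m - r
    from-preimage (i , hit) = toℕ i , FinP.toℕ<n i , same-residue⇒congruent N (c (toℕ i)) r
      (trans (sym (residue-toℕ i)) (trans (cong toℕ hit) (FinP.toℕ-fromℕ< _)))

  offset-below : ∀ q k → q ℕ.≤ k → k ℕ.< 2 ℕ.* q → k ∸ q ℕ.< q
  offset-below q k q≤k k<2q = ℕP.+-cancelˡ-< q (k ∸ q) q
    (subst₂ ℕ._<_ (sym (ℕP.m+[n∸m]≡n q≤k)) (cong (q ℕ.+_) (ℕP.+-identityʳ q)) k<2q)

  digit-bound : ∀ q N m j → j ℕ.< q → m ℕ.< N → q ℕ.* m ℕ.+ j ℕ.< q ℕ.* N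
  digit-bound q N m j j<q m<N = ℕP.<-≤-trans (ℕP.+-monoʳ-< (q ℕ.* m) j<q)
    (subst (ℕ._≤ q ℕ.* N) (trans (ℕP.*-suc q m) (ℕP.+-comm q (q ℕ.* m))) (ℕP.*-monoʳ-≤ q m<N))

  digit-congruent : ∀ q m j → + q ∣ + (q ℕ.* m ℕ.+ j) - + (q ℕ.+ j)
  digit-congruent q m j = divides (+ m - + 1) (begin
    + (q ℕ.* m ℕ.+ j) - + (q ℕ.+ j)
      ≡⟨ cong₂ _-_ (trans (ZP.pos-+ (q ℕ.* m) j) (cong (_+ + j) (ZP.pos-* q m))) (ZP.pos-+ q j) ⟩
    (+ q * + m + + j) - (+ q + + j)
      ≡⟨ shift (+ q) (+ m) (+ j) ⟩
    (+ m - + 1) * + q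
      ∎)
    where
    shift : ∀ q m j → (q * m + j) - (q + j) ≡ (m - + 1) * q
    shift = solve-∀

  short⇒not-divisible : ∀ q c → 0 ℕ.< ∣ c ∣ → ∣ c ∣ ℕ.< q → ¬ (+ q ∣ c)
  short⇒not-divisible q c 0<∣c∣ ∣c∣<q q∣c =
    ℕP.<⇒≱ ∣c∣<q (ℕD.∣⇒≤ {{ℕ.>-nonZero 0<∣c∣}} (∣⇒∣ᵤ q∣c))

  module AtPrime (p : ℕ) (p-prime : Prime p) where

    instance
      p≢0 : NonZero p
      p≢0 = prime⇒nonZero p-prime

    P : ℤ
    P = + p

    prime-divides-product : ∀ x y → P ∣ x * y → (P ∣ x) ⊎ (P ∣ y)
    prime-divides-product x y P∣xy
      with euclidsLemma ∣ x ∣ ∣ y ∣ p-prime (subst (p ℕD.∣_) (ZP.abs-* x y) (∣⇒∣ᵤ P∣xy))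
    ... | inj₁ p∣x = inj₁ (∣ᵤ⇒∣ p∣x)
    ... | inj₂ p∣y = inj₂ (∣ᵤ⇒∣ p∣y)

    p^[1+t] : ∀ t → + (p ^ suc t) ≡ P * + (p ^ t)
    p^[1+t] t = ZP.pos-* p (p ^ t)

    P∣p^[1+t] : ∀ t → P ∣ + (p ^ suc t)
    P∣p^[1+t] t = divides (+ (p ^ t)) (trans (p^[1+t] t) (ZP.*-comm P _))

    p∤1 : ¬ (P ∣ + 1)
    p∤1 P∣1 = ¬prime[1] (subst Prime (ℕD.∣1⇒≡1 (∣⇒∣ᵤ P∣1)) p-prime)

    cancel-unit : ∀ b x w → ¬ (P ∣ w) → + (p ^ b) ∣ x * w → + (p ^ b) ∣ x
    cancel-unit zero    x w _   _ = divides x (sym (ZP.*-identityʳ x))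
    cancel-unit (suc b) x w p∤w p^[1+b]∣xw
      with prime-divides-product x w (∣-trans (P∣p^[1+t] b) p^[1+b]∣xw)
    ... | inj₂ p∣w = ⊥-elim (p∤w p∣w)
    ... | inj₁ (divides x′ refl) =
      subst₂ _∣_ (sym (p^[1+t] b)) (ZP.*-comm P x′)
        (*-monoʳ-∣ P (cancel-unit b x′ w p∤w
          (*-cancelˡ-∣ P (subst₂ _∣_ (p^[1+t] b) (reassoc x′ P w) p^[1+b]∣xw))))
      where
      reassoc : ∀ x′ π w → x′ * π * w ≡ π * (x′ * w)
      reassoc = solve-∀

    record UnitLipschitz (U : ℤ → ℤ) : Set where
      field
        lipschitz  : ∀ x y → P * (x - y) ∣ U x - U y
        unit-value : ∀ x → ¬ (P ∣ U x)

    -- Products of unit-valued p-Lipschitz functions are again such, because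
    -- U(x)V(x) − U(y)V(y) = U(x)(V(x) − V(y)) + V(y)(U(x) − U(y)).
    *-unitLipschitz : ∀ {U V} → UnitLipschitz U → UnitLipschitz V →
      UnitLipschitz (λ x → U x * V x)
    *-unitLipschitz {U} {V} u v = record
      { lipschitz  = λ x y → subst (P * (x - y) ∣_) (sym (product-difference (U x) (V x) (U y) (V y)))
          (∣m∣n⇒∣m+n (∣n⇒∣m*n (U x) (lipschitz v x y)) (∣n⇒∣m*n (V y) (lipschitz u x y)))
      ; unit-value = λ x P∣UV → [ unit-value u x , unit-value v x ]′
          (prime-divides-product (U x) (V x) P∣UV)
      }
      where
      open UnitLipschitz
      product-difference : ∀ a b c d → a * b - c * d ≡ a * (b - d) + d * (a - c)
      product-difference = solve-∀

    record Factorisation (F : ℤ → ℤ) : Set where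
      field
        scale           : ℤ
        {{scale≢0}}     : Z.NonZero scale
        unitPart        : ℤ → ℤ
        factorises      : ∀ x → F x ≡ scale * unitPart x
        isUnitLipschitz : UnitLipschitz unitPart

    factorisation-cong : ∀ {F H} → (∀ x → F x ≡ H x) → Factorisation F → Factorisation H
    factorisation-cong F≗H f = record
      { scale = scale ; unitPart = unitPart
      ; factorises = λ x → trans (sym (F≗H x)) (factorises x)
      ; isUnitLipschitz = isUnitLipschitz }
      where open Factorisation f

    one-factorisation : Factorisation (λ _ → + 1)
    one-factorisation = record
      { scale = + 1 ; unitPart = λ _ → + 1 ; factorises = λ _ → refl
      ; isUnitLipschitz = record
        { lipschitz = λ x y → divides (+ 0) refl ; unit-value = λ _ → p∤1 } }

    *-factorisation : ∀ {F H} → Factorisation F → Factorisation H →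
      Factorisation (λ x → F x * H x)
    *-factorisation {F} {H} f h = record
      { scale = scale f * scale h
      ; unitPart = λ x → unitPart f x * unitPart h x
      ; factorises = λ x → trans (cong₂ _*_ (factorises f x) (factorises h x))
          (interchange (scale f) (unitPart f x) (scale h) (unitPart h x))
      ; isUnitLipschitz = *-unitLipschitz (isUnitLipschitz f) (isUnitLipschitz h)
      }
      where
      open Factorisation
      instance
        scale≢0′ : Z.NonZero (scale f * scale h)
        scale≢0′ = ZP.i*j≢0 (scale f) (scale h) {{scale≢0 f}} {{scale≢0 h}}
      interchange : ∀ a u b v → (a * u) * (b * v) ≡ (a * b) * (u * v)
      interchange = solve-∀

    times-p : ∀ a x → + (p ^ a) ∣ x → + (p ^ suc a) ∣ x * P
    times-p a x p^a∣x =
      subst (_∣ x * P) (trans (ZP.*-comm (+ (p ^ a)) P) (sym (p^[1+t] a))) (*-monoˡ-∣ P p^a∣x)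

    strip-p : ∀ a d → ¬ (+ (p ^ a) ∣ d) →
      Σ ℕ λ e → Σ ℕ λ t → Σ ℤ λ d′ → a ≡ e ℕ.+ suc t × d ≡ + (p ^ e) * d′ × ¬ (P ∣ d′)
    strip-p zero    d p^0∤d = ⊥-elim (p^0∤d (divides d (sym (ZP.*-identityʳ d))))
    strip-p (suc a) d p^[1+a]∤d with P ∣? d
    ... | no p∤d = 0 , a , d , refl , sym (ZP.*-identityˡ d) , p∤d
    ... | yes (divides d₁ refl) with strip-p a d₁ (λ p^a∣d₁ → p^[1+a]∤d (times-p a d₁ p^a∣d₁))
    ... | e , t , d′ , refl , refl , p∤d′ = suc e , t , d′ , refl , regroup , p∤d′
      where
      regroup : + (p ^ e) * d′ * P ≡ + (p ^ suc e) * d′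
      regroup = trans (shuffle (+ (p ^ e)) d′ P) (cong (_* d′) (sym (p^[1+t] e)))
        where
        shuffle : ∀ u d π → u * d * π ≡ π * u * d
        shuffle = solve-∀

    -- A linear function p^a·x + c with p^a ∤ c factorises: writing c = p^e·d′ as in
    -- strip-p, it is p^e · (p^(a−e)·x + d′).
    linear-factorisation : ∀ a c → ¬ (+ (p ^ a) ∣ c) → Factorisation (λ x → + (p ^ a) * x + c)
    linear-factorisation a c p^a∤c with strip-p a c p^a∤c
    ... | e , t , d′ , refl , refl , p∤d′ = record
      { scale = + (p ^ e)
      ; unitPart = λ x → + (p ^ suc t) * x + d′
      ; factorises = λ x → trans
          (cong (λ z → z * x + + (p ^ e) * d′)
            (trans (cong +_ (ℕP.^-distribˡ-+-* p e (suc t))) (ZP.pos-* (p ^ e) (p ^ suc t))))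
          (factor-out (+ (p ^ e)) (+ (p ^ suc t)) x d′)
      ; isUnitLipschitz = record
        { lipschitz = λ x y → divides (+ (p ^ t))
            (trans (cong (λ z → (z * x + d′) - (z * y + d′)) (p^[1+t] t))
                   (difference P (+ (p ^ t)) x y d′))
        ; unit-value = λ x P∣ux → p∤d′ (∣m+n∣m⇒∣n P∣ux (∣m⇒∣m*n x (P∣p^[1+t] t)))
        }
      }
      where
      instance
        p^e≢0 : Z.NonZero (+ (p ^ e))
        p^e≢0 = ℕP.m^n≢0 p e
      factor-out : ∀ u v x d → u * v * x + u * d ≡ u * (v * x + d)
      factor-out = solve-∀
      difference : ∀ π T x y d → (π * T * x + d) - (π * T * y + d) ≡ T * (π * (x - y))
      difference = solve-∀

    falling-factorisation : ∀ a c t → (∀ s → s ℕ.< t → ¬ (+ (p ^ a) ∣ c - + s)) →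
      Factorisation (λ x → falling (+ (p ^ a) * x + c) t)
    falling-factorisation a c zero    _      = one-factorisation
    falling-factorisation a c (suc t) avoids = factorisation-cong regroup
      (*-factorisation (linear-factorisation a c first) (falling-factorisation a (c - + 1) t rest))
      where
      first : ¬ (+ (p ^ a) ∣ c)
      first = subst (λ z → ¬ (+ (p ^ a) ∣ z)) (ZP.+-identityʳ c) (avoids 0 ℕ.z<s)
      rest : ∀ s → s ℕ.< t → ¬ (+ (p ^ a) ∣ c - + 1 - + s)
      rest s s<t = subst (λ z → ¬ (+ (p ^ a) ∣ z)) (sym (minus-suc c s)) (avoids (suc s) (ℕ.s<s s<t))
      regroup : ∀ x → (+ (p ^ a) * x + c) * falling (+ (p ^ a) * x + (c - + 1)) t
                    ≡ falling (+ (p ^ a) * x + c) (suc t)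
      regroup x = cong (λ z → (+ (p ^ a) * x + c) * falling z t) (sym (ZP.+-assoc (+ (p ^ a) * x) c (- + 1)))

    -- Writing U(m₁) − U(m₂) = X·p(m₁ − m₂), one has
    -- (c(m₁) − c(m₂))·U(1) = (m₁ − m₂)·(U(m₁) + m₂·p·X), and both U(1) and
    -- U(m₁) + m₂·p·X are prime to p.
    normalised-reflects-congruence : (c : ℕ → ℤ) {U : ℤ → ℤ} → UnitLipschitz U →
      (∀ m → c m * U (+ 1) ≡ + m * U (+ m)) →
      ∀ b m₁ m₂ → + (p ^ b) ∣ c m₁ - c m₂ → + (p ^ b) ∣ + m₁ - + m₂
    normalised-reflects-congruence c {U} u normalised b m₁ m₂ p^b∣Δc
      with UnitLipschitz.lipschitz u (+ m₁) (+ m₂)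
    ... | divides X U-step = cancel-unit b (+ m₁ - + m₂) W p∤W
            (subst (+ (p ^ b) ∣_) expand (∣m⇒∣m*n (U (+ 1)) p^b∣Δc))
      where
      W : ℤ
      W = U (+ m₁) + + m₂ * (P * X)
      p∤W : ¬ (P ∣ W)
      p∤W P∣W = UnitLipschitz.unit-value u (+ m₁)
        (∣m+n∣n⇒∣m P∣W (∣n⇒∣m*n (+ m₂) (∣m⇒∣m*n X (∣-refl {P}))))
      U-m₂ : U (+ m₂) ≡ U (+ m₁) - X * (P * (+ m₁ - + m₂))
      U-m₂ = trans (double-negation (U (+ m₁)) (U (+ m₂))) (cong (λ z → U (+ m₁) - z) U-step)
        where
        double-negation : ∀ a b → b ≡ a - (a - b)
        double-negation = solve-∀
      expand : (c m₁ - c m₂) * U (+ 1) ≡ (+ m₁ - + m₂) * W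
      expand = begin
        (c m₁ - c m₂) * U (+ 1)
          ≡⟨ distribute (c m₁) (c m₂) (U (+ 1)) ⟩
        c m₁ * U (+ 1) - c m₂ * U (+ 1)
          ≡⟨ cong₂ _-_ (normalised m₁) (normalised m₂) ⟩
        + m₁ * U (+ m₁) - + m₂ * U (+ m₂)
          ≡⟨ cong (λ z → + m₁ * U (+ m₁) - + m₂ * z) U-m₂ ⟩
        + m₁ * U (+ m₁) - + m₂ * (U (+ m₁) - X * (P * (+ m₁ - + m₂)))
          ≡⟨ collect (+ m₁) (+ m₂) (U (+ m₁)) X P ⟩
        (+ m₁ - + m₂) * W
          ∎
        where
        distribute : ∀ a b u → (a - b) * u ≡ a * u - b * u
        distribute = solve-∀
        collect : ∀ x₁ x₂ u X π → x₁ * u - x₂ * (u - X * (π * (x₁ - x₂))) ≡ (x₁ - x₂) * (u + x₂ * (π * X))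
        collect = solve-∀

    module Binomials (a j : ℕ) (j<q : j ℕ.< p ^ a) where

      q : ℕ
      q = p ^ a

      instance
        q≢0 : NonZero q
        q≢0 = ℕP.m^n≢0 p a

      Q : ℤ
      Q = + q

      binomialAt : ℕ → ℤ
      binomialAt m = + ((q ℕ.* m ℕ.+ j) C (q ℕ.+ j))

      -- C(q·m + j, q + j)·(q + j)! = (q·m + j)^(j) · q·m · (q·m − 1)^(q−1); these two
      -- falling factorials consist of the factors q·m + c for 0 < |c| < q.
      lower upper : ℤ → ℤ
      lower x = falling (Q * x + + j) j
      upper x = falling (Q * x - + 1) (ℕ.pred q)

      -- The shifts are c = j − s (s < j) and c = −1 − s (s < q − 1), all with 0 < |c| < q.
      lower-upper-factorisation : Factorisation (λ x → lower x * upper x)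
      lower-upper-factorisation = *-factorisation
        (falling-factorisation a (+ j) j λ s s<j →
          subst (λ z → ¬ (Q ∣ z)) (sym (trans (ZP.m-n≡m⊖n j s) (ZP.⊖-≥ (ℕP.<⇒≤ s<j))))
            (short⇒not-divisible q (+ (j ∸ s)) (ℕP.m<n⇒0<n∸m s<j) (ℕP.≤-<-trans (ℕP.m∸n≤m j s) j<q)))
        (falling-factorisation a (- + 1) (ℕ.pred q) λ s s<q-1 →
          subst (λ z → ¬ (Q ∣ z)) (ZP.neg-distrib-+ (+ 1) (+ s))
            (short⇒not-divisible q (- + suc s) ℕ.z<s
              (subst (suc s ℕ.<_) (ℕP.suc-pred q) (ℕ.s<s s<q-1))))

      open Factorisation lower-upper-factorisation

      instance
        Q*scale≢0 : Z.NonZero (Q * scale)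
        Q*scale≢0 = ZP.i*j≢0 Q scale {{q≢0}} {{scale≢0}}

      binomial-expansion : ∀ m →
        binomialAt m * + ((q ℕ.+ j) !) ≡ Q * (+ m * (lower (+ m) * upper (+ m)))
      binomial-expansion m = begin
        binomialAt m * + ((q ℕ.+ j) !)
          ≡⟨ binomial-falling (q ℕ.* m ℕ.+ j) (q ℕ.+ j) ⟩
        falling (+ (q ℕ.* m ℕ.+ j)) (q ℕ.+ j)
          ≡⟨ cong₂ falling n-in-digits (ℕP.+-comm q j) ⟩
        falling (Q * + m + + j) (j ℕ.+ q)
          ≡⟨ falling-split (Q * + m + + j) j q ⟩
        lower (+ m) * falling (Q * + m + + j - + j) q
          ≡⟨ cong (λ z → lower (+ m) * falling z q) (cancel-j (Q * + m) (+ j)) ⟩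
        lower (+ m) * falling (Q * + m) q
          ≡⟨ cong (lower (+ m) *_) (cong (falling (Q * + m)) (sym (ℕP.suc-pred q))) ⟩
        lower (+ m) * (Q * + m * upper (+ m))
          ≡⟨ regroup (lower (+ m)) Q (+ m) (upper (+ m)) ⟩
        Q * (+ m * (lower (+ m) * upper (+ m)))
          ∎
        where
        n-in-digits : + (q ℕ.* m ℕ.+ j) ≡ Q * + m + + j
        n-in-digits = trans (ZP.pos-+ (q ℕ.* m) j) (cong (_+ + j) (ZP.pos-* q m))
        cancel-j : ∀ x y → x + y - y ≡ x
        cancel-j = solve-∀
        regroup : ∀ l Q m u → l * (Q * m * u) ≡ Q * (m * (l * u))
        regroup = solve-∀

      binomial-normalised : ∀ m → binomialAt m * unitPart (+ 1) ≡ + m * unitPart (+ m)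
      binomial-normalised = normalise-at-one binomialAt unitPart (+ ((q ℕ.+ j) !)) (Q * scale)
        at-one
        λ m → trans (binomial-expansion m)
          (trans (cong (λ z → Q * (+ m * z)) (factorises (+ m))) (regroup Q (+ m) scale (unitPart (+ m))))
        where
        at-one : binomialAt 1 ≡ + 1
        at-one = trans (cong (λ n → + (n C (q ℕ.+ j))) (cong (ℕ._+ j) (ℕP.*-identityʳ q)))
                       (cong +_ (nCn≡1 (q ℕ.+ j)))
        regroup : ∀ Q m s u → Q * (m * (s * u)) ≡ (Q * s) * (m * u)
        regroup = solve-∀

      binomial-attains : ∀ b r → ∃ λ m → m ℕ.< p ^ b × + (p ^ b) ∣ binomialAt m - r
      binomial-attains b = hits-every-residue (p ^ b) {{ℕP.m^n≢0 p b}} binomialAt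
        λ m₁ m₂ m₁<N m₂<N N∣ → small-congruent⇒equal (p ^ b) m₁ m₂ {{ℕP.m^n≢0 p b}} m₁<N m₂<N
          (normalised-reflects-congruence binomialAt isUnitLipschitz binomial-normalised b m₁ m₂ N∣)

open Development using (offset-below; digit-bound; digit-congruent; module AtPrime)
open import Data.Nat using (ℕ; _+_; _^_; _≤_; _<_; _*_; _∸_)
import Data.Nat.Properties as ℕP
open import Data.Nat.Primality using (Prime)
open import Data.Nat.Combinatorics using (_C_)
open import Data.Integer using (ℤ; +_; _-_)
open import Data.Integer.Divisibility.Signed using (_∣_; ∣⇒∣ᵤ)
open import Data.Product using (∃; ∃-syntax; _×_; _,_)
open import Relation.Binary.PropositionalEquality using (_≡_; subst; sym)

theorem1p1 : (p a k : ℕ) → Prime p → p ^ a ≤ k → k < 2 * p ^ a →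
    (b : ℕ) (r : ℤ) →
    ∃[ n ] (n < p ^ (a + b) × (+ n) ≡ (+ k) [mod (+ (p ^ a)) ] × (+ (n C k)) ≡ r [mod (+ (p ^ b)) ])
theorem1p1 p a k p-prime p^a≤k k<2p^a b r = from-digit (binomial-attains b r)
  where
  open AtPrime p p-prime
  j : ℕ
  j = k ∸ p ^ a
  open Binomials a j (offset-below (p ^ a) k p^a≤k k<2p^a)
  k≡q+j : p ^ a + j ≡ k
  k≡q+j = ℕP.m+[n∸m]≡n p^a≤k
  from-digit : ∃ (λ m → m < p ^ b × + (p ^ b) ∣ binomialAt m - r) →
    ∃[ n ] (n < p ^ (a + b) × (+ n) ≡ (+ k) [mod (+ (p ^ a)) ] × (+ (n C k)) ≡ r [mod (+ (p ^ b)) ])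
  from-digit (m , m<p^b , p^b∣Cm-r) = p ^ a * m + j
    , subst (p ^ a * m + j <_) (sym (ℕP.^-distribˡ-+-* p a b))
        (digit-bound (p ^ a) (p ^ b) m j (offset-below (p ^ a) k p^a≤k k<2p^a) m<p^b)
    , ∣⇒∣ᵤ (subst (λ k′ → + (p ^ a) ∣ + (p ^ a * m + j) - + k′) k≡q+j (digit-congruent (p ^ a) m j))
    , ∣⇒∣ᵤ (subst (λ k′ → + (p ^ b) ∣ + ((p ^ a * m + j) C k′) - r) k≡q+j p^b∣Cm-r)
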